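{- For all integers $n\geq 0$ and $k\geq 1$, $d(n,k)\leq 2^{n(n-1)/2}\,k^n$.
   Context: Consider the infinite rooted tree with labelled nodes in which a node labelled $(k)$ has exactly $k$ children, labelled $(k+1),(k+2),\ldots,(2k)$. For $n\geq 0$ and $k\geq 1$, $d(n,k)$ denotes the number of $n$th-generation descendants of a node labelled $(k)$ (so $d(0,k)=1$, $d(1,k)=k$, and $d(n,k)=\sum_{j=k+1}^{2k}d(n-1,j)$ for $n\geq 1$). -}

module Defs where

open import Data.Nat using (ℕ; zero; suc; _+_; _*_)

-- d n k = number of n-th generation descendants of a node labelled (k),
-- where a node (k) has children (k+1), …, (2k).
-- d 0 k = 1 ;  d (n+1) k = Σ_{j=k+1}^{2k} d n j.
mutual
  d : ℕ → ℕ → ℕ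
  d zero    k = 1
  d (suc n) k = sumD n (suc k) k

  sumD : ℕ → ℕ → ℕ → ℕ
  sumD n a zero    = 0
  sumD n a (suc m) = d n a + sumD n (suc a) m

-- Write B n k = 2^(n(n-1)/2) · k^n. The k children of (k)
-- have labels at most 2k and B n is monotone, so d (n+1) k ≤ k · B n (2k); and
-- k · B n (2k) = B (n+1) k exactly, since 2^(n(n-1)/2) · 2^n = 2^((n+1)n/2).
module Submission where

open import Defs
open import Data.Nat using (ℕ; zero; suc; _+_; _*_; _∸_; _^_; _≤_; _<_; _≥_; z≤n; z<s)
open import Data.Nat.DivMod using (_/_; m*n/n≡m)
open import Data.Nat.Properties
open import Data.Nat.Tactic.RingSolver using (solve)
open import Data.List.Base using ([]; _∷_)
open import Relation.Binary.PropositionalEquality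
open import Algebra.Properties.CommutativeSemigroup *-commutativeSemigroup using (x∙yz≈y∙xz)

triangular : ℕ → ℕ
triangular zero    = 0
triangular (suc n) = triangular n + n

triangular*2≡n*[n∸1] : ∀ n → triangular n * 2 ≡ n * (n ∸ 1)
triangular*2≡n*[n∸1] zero          = refl
triangular*2≡n*[n∸1] (suc zero)    = refl
triangular*2≡n*[n∸1] (suc (suc m)) = begin
  (triangular (suc m) + suc m) * 2   ≡⟨ *-distribʳ-+ 2 (triangular (suc m)) (suc m) ⟩
  triangular (suc m) * 2 + suc m * 2 ≡⟨ cong (_+ suc m * 2) (triangular*2≡n*[n∸1] (suc m)) ⟩
  suc m * m + suc m * 2              ≡⟨ solve (m ∷ []) ⟩
  suc (suc m) * suc m                ∎
  where open ≡-Reasoning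

n*[n∸1]/2≡triangular : ∀ n → n * (n ∸ 1) / 2 ≡ triangular n
n*[n∸1]/2≡triangular n = begin
  n * (n ∸ 1) / 2        ≡⟨ cong (_/ 2) (triangular*2≡n*[n∸1] n) ⟨
  triangular n * 2 / 2   ≡⟨ m*n/n≡m (triangular n) 2 ⟩
  triangular n           ∎
  where open ≡-Reasoning

^-distribʳ-* : ∀ m n o → (m * n) ^ o ≡ m ^ o * n ^ o
^-distribʳ-* m n zero    = refl
^-distribʳ-* m n (suc o) = begin
  m * n * (m * n) ^ o       ≡⟨ cong (m * n *_) (^-distribʳ-* m n o) ⟩
  m * n * (m ^ o * n ^ o)   ≡⟨ [m*n]*[o*p]≡[m*o]*[n*p] m n (m ^ o) (n ^ o) ⟩
  m * m ^ o * (n * n ^ o)   ∎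
  where open ≡-Reasoning

sumD≤m*B : ∀ n a m {B} → (∀ j → a ≤ j → j < a + m → d n j ≤ B) →
               sumD n a m ≤ m * B
sumD≤m*B n a zero    d≤B = z≤n
sumD≤m*B n a (suc m) d≤B =
  +-mono-≤ (d≤B a ≤-refl (m<m+n a z<s))
           (sumD≤m*B n (suc a) m λ j a<j j<1+a+m →
             d≤B j (<⇒≤ a<j) (≤-trans j<1+a+m (≤-reflexive (sym (+-suc a m)))))

bound : ℕ → ℕ → ℕ
bound n k = 2 ^ triangular n * k ^ n

bound-monoʳ-≤ : ∀ n {j k} → j ≤ k → bound n j ≤ bound n k
bound-monoʳ-≤ n j≤k = *-monoʳ-≤ (2 ^ triangular n) (^-monoˡ-≤ n j≤k)

k*bound[n,k+k]≡bound[1+n,k] : ∀ n k → k * bound n (k + k) ≡ bound (suc n) k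
k*bound[n,k+k]≡bound[1+n,k] n k = begin
  k * (2 ^ t * (k + k) ^ n)        ≡⟨ cong (λ x → k * (2 ^ t * (k + x) ^ n)) (+-identityʳ k) ⟨
  k * (2 ^ t * (2 * k) ^ n)        ≡⟨ cong (λ x → k * (2 ^ t * x)) (^-distribʳ-* 2 k n) ⟩
  k * (2 ^ t * (2 ^ n * k ^ n))    ≡⟨ cong (k *_) (*-assoc (2 ^ t) (2 ^ n) (k ^ n)) ⟨
  k * (2 ^ t * 2 ^ n * k ^ n)      ≡⟨ cong (λ x → k * (x * k ^ n)) (^-distribˡ-+-* 2 t n) ⟨
  k * (2 ^ (t + n) * k ^ n)        ≡⟨ x∙yz≈y∙xz k (2 ^ (t + n)) (k ^ n) ⟩
  2 ^ (t + n) * (k * k ^ n)        ∎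
  where
  open ≡-Reasoning
  t : ℕ
  t = triangular n

d≤bound : ∀ n k → d n k ≤ bound n k
d≤bound zero    k = ≤-refl
d≤bound (suc n) k = begin
  sumD n (suc k) k      ≤⟨ sumD≤m*B n (suc k) k child≤bound ⟩
  k * bound n (k + k)   ≡⟨ k*bound[n,k+k]≡bound[1+n,k] n k ⟩
  bound (suc n) k       ∎
  where
  open ≤-Reasoning
  child≤bound : ∀ j → suc k ≤ j → j < suc k + k → d n j ≤ bound n (k + k)
  child≤bound j _ j<1+k+k = ≤-trans (d≤bound n j) (bound-monoʳ-≤ n (m<1+n⇒m≤n j<1+k+k))

lemma2 : (n k : ℕ) → k ≥ 1 → d n k ≤ 2 ^ ((n * (n ∸ 1)) / 2) * k ^ n
lemma2 n k _ rewrite n*[n∸1]/2≡triangular n = d≤bound n k
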